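{- For $n\ge 1$ let $R_n(x)=\sum_{\sigma\in\mathcal{S}_n} x^{\overleftarrow{des}_E(\sigma)}$. Then $R_1(x)=1$, $R_2(x)=1+x$, and for all $n\ge1$, $$R_{2n+1}(x)=(1-x)\frac{d}{dx}R_{2n}(x)+(1+2n)R_{2n}(x),$$ $$R_{2n+2}(x)=x(1-x)\frac{d}{dx}R_{2n+1}(x)+(1+x(1+2n))R_{2n+1}(x).$$
   Context: $\mathcal{S}_n$ denotes the set of permutations $\sigma=\sigma_1\sigma_2\cdots\sigma_n$ of $\{1,\dots,n\}$. For such $\sigma$, $\overleftarrow{des}_E(\sigma)$ is the number of indices $i\in\{1,\dots,n-1\}$ such that $\sigma_i>\sigma_{i+1}$ and $\sigma_i$ is even. -}

module Defs where

open import Data.Nat using (ℕ; zero; suc; _∸_; _≡ᵇ_; _<ᵇ_; _%_)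
open import Data.Bool using (Bool; true; false; _∧_; if_then_else_)
open import Data.List using (List; []; _∷_; concatMap; map; length; filterᵇ; upTo)
open import Data.Integer using (ℤ; +_; _+_; _*_; _-_)

-- Permutations of {1,…,n} written in one-line notation σ₁σ₂⋯σₙ, as lists.

insertions : ℕ → List ℕ → List (List ℕ)
insertions a []       = (a ∷ []) ∷ []
insertions a (b ∷ bs) = (a ∷ b ∷ bs) ∷ map (b ∷_) (insertions a bs)

𝒮 : ℕ → List (List ℕ)
𝒮 zero    = [] ∷ []
𝒮 (suc n) = concatMap (insertions (suc n)) (𝒮 n)

isEven : ℕ → Bool
isEven m = m % 2 ≡ᵇ 0

desE : List ℕ → ℕ
desE []            = 0
desE (a ∷ [])      = 0
desE (a ∷ b ∷ bs) =
  (if (b <ᵇ a) ∧ isEven a then 1 else 0) Data.Nat.+ desE (b ∷ bs)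

-- Polynomials with integer coefficients, represented by their coefficient
-- sequences  P k = [x^k] P  (only finitely many nonzero for the ones used).
Poly : Set
Poly = ℕ → ℤ

R : ℕ → Poly
R n k = + length (filterᵇ (λ σ → desE σ ≡ᵇ k) (𝒮 n))

const : ℤ → Poly
const c zero    = c
const c (suc k) = + 0

infixl 6 _⊕_ _⊖_
infixl 7 _⊗_ _⊛_
_⊕_ : Poly → Poly → Poly
(P ⊕ Q) k = P k + Q k

_⊖_ : Poly → Poly → Poly
(P ⊖ Q) k = P k - Q k

_⊛_ : ℤ → Poly → Poly
(c ⊛ P) k = c * P k

X· : Poly → Poly
X· P zero    = + 0
X· P (suc k) = P k

D : Poly → Poly
D P k = + (suc k) * P (suc k)

Σ≤ : ℕ → (ℕ → ℤ) → ℤ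
Σ≤ zero    f = f zero
Σ≤ (suc k) f = Σ≤ k f + f (suc k)

_⊗_ : Poly → Poly → Poly
(P ⊗ Q) k = Σ≤ k (λ i → P i * Q (k ∸ i))

𝕏 : Poly
𝕏 = X· (const (+ 1))

module Submission where

-- Every permutation of {1,…,m+1} arises exactly once by inserting a = m+1 into a permutation σ
-- of {1,…,m}. Inserting a into the slot before σᵢ₊₁ keeps (σᵢ, a) an ascent, destroys the pair
-- (σᵢ, σᵢ₊₁), and creates the descent (a, σᵢ₊₁), which counts iff a is even. So with d = desE σ,
-- an odd a yields d − 1 from the d slots inside a descent with even top and d from the other m + 1 − d
-- slots, while an even a yields d from those d slots and the last slot, and d + 1 from the other
-- m − d. In both cases, for D = [a even] + d, exactly D insertions have value D − 1 and the rest
-- value D. Summing over σ, the number of permutations of {1,…,m+1} with desE = k is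
-- (k+1)·N(k+1) + (m+1−k)·N(k), where N counts the σ by [a even] + desE σ; this is the
-- coefficient of xᵏ in (1−x)R′ₘ + (m+1)Rₘ for odd a and in x(1−x)R′ₘ + (1+mx)Rₘ for even a.

open import Defs
open import Data.Nat using (ℕ; suc; _+_; _*_)
open import Data.Integer using (+_)
open import Data.Product using (_×_)
open import Relation.Binary.PropositionalEquality using (_≡_)

open import Data.Product using (_,_)
open import Data.Bool using (Bool; true; false; T; if_then_else_; _∧_)
open import Data.Bool.Properties using (T-≡)
open import Data.Integer using (ℤ) renaming (_+_ to _+ᶻ_; _*_ to _*ᶻ_; _-_ to _-ᶻ_)
import Data.Integer.Properties as ℤ
open import Data.Integer.Tactic.RingSolver using (solve-∀)
open import Data.List using (List; []; _∷_; _++_; map; length; filterᵇ; concatMap)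
open import Data.List.Properties using (filter-++; length-++)
open import Data.List.Relation.Unary.All as All using (All; []; _∷_)
open import Data.List.Relation.Unary.All.Properties using (map⁺; concat⁺)
open import Data.Nat using (zero; _∸_; _≤_; _<_; _≤?_; _≡ᵇ_; _<ᵇ_; _%_; z≤n; s≤s⁻¹)
open import Data.Nat.DivMod using (m*n%n≡0; [m+kn]%n≡m%n)
open import Data.Nat.Properties
  using (≡ᵇ⇒≡; <ᵇ⇒<; <⇒<ᵇ; ≤-refl; ≤-trans; n≤1+n; <-asym; <⇒≢; ≤-<-trans; m<n⇒m<1+n;
         ≰⇒>; +-mono-≤; +-assoc; +-comm; +-suc; *-suc; *-comm; *-zeroʳ; +-∸-assoc; +-commutativeSemigroup)
open import Algebra.Properties.CommutativeSemigroup +-commutativeSemigroup using (x∙yz≈y∙xz)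
import Data.Nat.Tactic.RingSolver as ℕ-Solver
open import Function using (_∘_; Equivalence)
open import Relation.Binary.PropositionalEquality
  using (refl; sym; trans; cong; cong₂; subst; module ≡-Reasoning)
open import Relation.Nullary using (yes; no; contradiction)

open ≡-Reasoning

𝟙 : Bool → ℕ
𝟙 b = if b then 1 else 0

𝟙≤1 : ∀ b → 𝟙 b ≤ 1
𝟙≤1 true  = ≤-refl
𝟙≤1 false = z≤n

≡true⇒T : ∀ {b} → b ≡ true → T b
≡true⇒T = Equivalence.from T-≡

≡ᵇ≡true⇒≡ : ∀ {m n} → (m ≡ᵇ n) ≡ true → m ≡ n
≡ᵇ≡true⇒≡ {m} {n} eq = ≡ᵇ⇒≡ m n (≡true⇒T eq)

<⇒<ᵇ≡true : ∀ {m n} → m < n → (m <ᵇ n) ≡ true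
<⇒<ᵇ≡true m<n = Equivalence.to T-≡ (<⇒<ᵇ m<n)

>⇒<ᵇ≡false : ∀ {m n} → n < m → (m <ᵇ n) ≡ false
>⇒<ᵇ≡false {m} {n} n<m with m <ᵇ n in eq
... | false = refl
... | true  = contradiction (<ᵇ⇒< m n (≡true⇒T eq)) (<-asym n<m)

shift : (ℕ → ℕ) → ℕ → ℕ
shift F zero    = 0
shift F (suc k) = F k

private variable A B : Set

-- R n k is definitionally + count desE (𝒮 n) k.
count : (A → ℕ) → List A → ℕ → ℕ
count f xs k = length (filterᵇ (λ x → f x ≡ᵇ k) xs)

count-∷ : ∀ (f : A → ℕ) x xs k → count f (x ∷ xs) k ≡ 𝟙 (f x ≡ᵇ k) + count f xs k
count-∷ f x xs k with f x ≡ᵇ k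
... | true  = refl
... | false = refl

count-++ : ∀ (f : A → ℕ) xs ys k → count f (xs ++ ys) k ≡ count f xs k + count f ys k
count-++ f xs ys k = trans (cong length (filter-++ _ xs ys)) (length-++ (filterᵇ _ xs))

count-map : ∀ (f : A → ℕ) (g : B → A) xs k → count f (map g xs) k ≡ count (f ∘ g) xs k
count-map f g []       k = refl
count-map f g (x ∷ xs) k = begin
  count f (g x ∷ map g xs) k
    ≡⟨ count-∷ f (g x) (map g xs) k ⟩
  𝟙 (f (g x) ≡ᵇ k) + count f (map g xs) k
    ≡⟨ cong (λ c → 𝟙 (f (g x) ≡ᵇ k) + c) (count-map f g xs k) ⟩
  𝟙 (f (g x) ≡ᵇ k) + count (f ∘ g) xs k
    ≡⟨ sym (count-∷ (f ∘ g) x xs k) ⟩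
  count (f ∘ g) (x ∷ xs) k ∎

count-suc : ∀ (f : A → ℕ) xs k → count (suc ∘ f) xs k ≡ shift (count f xs) k
count-suc f []       zero    = refl
count-suc f (x ∷ xs) zero    = count-suc f xs zero
count-suc f xs       (suc k) = refl

count-≡0 : ∀ {f : A → ℕ} {xs k} → All (λ x → f x < k) xs → count f xs k ≡ 0
count-≡0 []                         = refl
count-≡0 {f = f} {x ∷ xs} {k} (fx<k ∷ ps) with f x ≡ᵇ k in eq
... | false = count-≡0 ps
... | true  = contradiction (≡ᵇ≡true⇒≡ eq) (<⇒≢ fx<k)

-- The distribution of a list of n numbers of which D are equal to D ∸ 1 and the others to D.
spread : ℕ → ℕ → ℕ → ℕ
spread D n k = 𝟙 (D ≡ᵇ suc k) * suc k + 𝟙 (D ≡ᵇ k) * (n ∸ k)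

spread-singleton : ∀ β k → 𝟙 (0 ≡ᵇ k) + 0 ≡ spread (𝟙 β + 0) 1 k
spread-singleton false zero          = refl
spread-singleton false (suc k)       = refl
spread-singleton true  zero          = refl
spread-singleton true  (suc zero)    = refl
spread-singleton true  (suc (suc k)) = refl

spread-suc : ∀ {D n} k → D ≤ n → 𝟙 (D ≡ᵇ k) + spread D n k ≡ spread D (suc n) k
spread-suc {D} {n} k D≤n with D ≡ᵇ k in D≡ᵇk
... | false = refl
... | true  = begin
  1 + (x + 1 * (n ∸ k))   ≡⟨ shuffle x (n ∸ k) ⟩
  x + 1 * (1 + (n ∸ k))   ≡⟨ cong (λ m → x + 1 * m) (sym (+-∸-assoc 1 k≤n)) ⟩
  x + 1 * (suc n ∸ k)     ∎
  where
  x = 𝟙 (D ≡ᵇ suc k) * suc k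
  k≤n = subst (_≤ n) (≡ᵇ≡true⇒≡ D≡ᵇk) D≤n
  shuffle : ∀ x y → 1 + (x + 1 * y) ≡ x + 1 * (1 + y)
  shuffle = ℕ-Solver.solve-∀

spread-shift : ∀ D n k → 𝟙 (D ≡ᵇ k) + shift (spread D n) k ≡ spread (suc D) (suc n) k
spread-shift zero    n zero    = refl
spread-shift (suc D) n zero    = refl
spread-shift D       n (suc k) = begin
  x + (x * suc k + y)  ≡⟨ sym (+-assoc x _ y) ⟩
  x + x * suc k + y    ≡⟨ cong (_+ y) (sym (*-suc x (suc k))) ⟩
  x * suc (suc k) + y  ∎
  where
  x = 𝟙 (D ≡ᵇ suc k)
  y = 𝟙 (D ≡ᵇ k) * (n ∸ k)

spread-extend : ∀ (f : A → ℕ) xs {D n} → D ≤ n → (∀ k → count f xs k ≡ spread D n k) →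
  ∀ β k → 𝟙 (D ≡ᵇ k) + count (λ x → 𝟙 β + f x) xs k ≡ spread (𝟙 β + D) (suc n) k
spread-extend f xs {D} D≤n dist false k =
  trans (cong (λ c → 𝟙 (D ≡ᵇ k) + c) (dist k)) (spread-suc k D≤n)
spread-extend f xs {D} {n} D≤n dist true k = begin
  𝟙 (D ≡ᵇ k) + count (suc ∘ f) xs k    ≡⟨ cong (λ c → 𝟙 (D ≡ᵇ k) + c) (count-suc f xs k) ⟩
  𝟙 (D ≡ᵇ k) + shift (count f xs) k    ≡⟨ cong (λ c → 𝟙 (D ≡ᵇ k) + c) (shift-dist k) ⟩
  𝟙 (D ≡ᵇ k) + shift (spread D n) k    ≡⟨ spread-shift D n k ⟩
  spread (suc D) (suc n) k             ∎
  where
  shift-dist : ∀ k → shift (count f xs) k ≡ shift (spread D n) k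
  shift-dist zero    = refl
  shift-dist (suc k) = dist k

desE-∷-≤ : ∀ a σ → desE (a ∷ σ) ≤ length σ
desE-∷-≤ a []      = z≤n
desE-∷-≤ a (b ∷ σ) = +-mono-≤ (𝟙≤1 ((b <ᵇ a) ∧ isEven a)) (desE-∷-≤ b σ)

desE-≤ : ∀ σ → desE σ ≤ length σ
desE-≤ []      = z≤n
desE-≤ (a ∷ σ) = ≤-trans (desE-∷-≤ a σ) (n≤1+n (length σ))

desE-descent : ∀ {a b} σ → b < a → desE (a ∷ b ∷ σ) ≡ 𝟙 (isEven a) + desE (b ∷ σ)
desE-descent σ b<a rewrite <⇒<ᵇ≡true b<a = refl

desE-ascent : ∀ {a b} σ → b < a → desE (b ∷ a ∷ σ) ≡ desE (a ∷ σ)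
desE-ascent σ b<a rewrite >⇒<ᵇ≡false b<a = refl

insertion-bound : ∀ a b σ → 𝟙 (isEven a) + desE (b ∷ σ) ≤ suc (length σ)
insertion-bound a b σ = +-mono-≤ (𝟙≤1 (isEven a)) (desE-∷-≤ b σ)

-- Generalised to the insertions behind a fixed first entry b so that the induction goes through:
-- for σ = c ∷ σ′ all but the first of them begin with b c, whose contribution to desE is fixed.
count-desE-insertions-after : ∀ {a} b σ → b < a → All (_< a) σ → ∀ k →
  count desE (map (b ∷_) (insertions a σ)) k ≡ spread (𝟙 (isEven a) + desE (b ∷ σ)) (suc (length σ)) k
count-desE-insertions-after {a} b [] b<a [] k = begin
  count desE ((b ∷ a ∷ []) ∷ []) k ≡⟨ count-∷ desE (b ∷ a ∷ []) [] k ⟩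
  𝟙 (desE (b ∷ a ∷ []) ≡ᵇ k) + 0  ≡⟨ cong (λ d → 𝟙 (d ≡ᵇ k) + 0) (desE-ascent [] b<a) ⟩
  𝟙 (0 ≡ᵇ k) + 0                  ≡⟨ spread-singleton (isEven a) k ⟩
  spread (𝟙 (isEven a) + 0) 1 k   ∎
count-desE-insertions-after {a} b (c ∷ σ) b<a (c<a ∷ σ<a) k = begin
  count desE ((b ∷ a ∷ c ∷ σ) ∷ map (b ∷_) (map (c ∷_) τs)) k
    ≡⟨ count-∷ desE (b ∷ a ∷ c ∷ σ) (map (b ∷_) (map (c ∷_) τs)) k ⟩
  𝟙 (desE (b ∷ a ∷ c ∷ σ) ≡ᵇ k) + count desE (map (b ∷_) (map (c ∷_) τs)) k
    ≡⟨ cong₂ (λ d m → 𝟙 (d ≡ᵇ k) + m)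
             (trans (desE-ascent (c ∷ σ) b<a) (desE-descent σ c<a)) pull-heads ⟩
  𝟙 (d ≡ᵇ k) + count (λ τ → 𝟙 β + desE (c ∷ τ)) τs k
    ≡⟨ spread-extend (λ τ → desE (c ∷ τ)) τs (insertion-bound a c σ) after-c β k ⟩
  spread (𝟙 β + d) (suc (suc (length σ))) k
    ≡⟨ cong (λ d → spread d (suc (suc (length σ))) k)
            (x∙yz≈y∙xz (𝟙 β) (𝟙 (isEven a)) (desE (c ∷ σ))) ⟩
  spread (𝟙 (isEven a) + desE (b ∷ c ∷ σ)) (suc (suc (length σ))) k ∎
  where
  τs = insertions a σ
  β  = (c <ᵇ b) ∧ isEven b
  d  = 𝟙 (isEven a) + desE (c ∷ σ)
  pull-heads : count desE (map (b ∷_) (map (c ∷_) τs)) k ≡ count (λ τ → 𝟙 β + desE (c ∷ τ)) τs k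
  pull-heads = trans (count-map desE (b ∷_) (map (c ∷_) τs) k)
                     (count-map (λ τ → desE (b ∷ τ)) (c ∷_) τs k)
  after-c : ∀ k → count (λ τ → desE (c ∷ τ)) τs k ≡ spread d (suc (length σ)) k
  after-c k = trans (sym (count-map desE (c ∷_) τs k)) (count-desE-insertions-after c σ c<a σ<a k)

count-desE-insertions : ∀ {a} σ → All (_< a) σ → ∀ k →
  count desE (insertions a σ) k ≡ spread (𝟙 (isEven a) + desE σ) (suc (length σ)) k
count-desE-insertions {a} [] [] k = trans (count-∷ desE (a ∷ []) [] k) (spread-singleton (isEven a) k)
count-desE-insertions {a} (b ∷ σ) (b<a ∷ σ<a) k = begin
  count desE ((a ∷ b ∷ σ) ∷ map (b ∷_) (insertions a σ)) k
    ≡⟨ count-∷ desE (a ∷ b ∷ σ) (map (b ∷_) (insertions a σ)) k ⟩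
  𝟙 (desE (a ∷ b ∷ σ) ≡ᵇ k) + count desE (map (b ∷_) (insertions a σ)) k
    ≡⟨ cong₂ (λ d m → 𝟙 (d ≡ᵇ k) + m)
             (desE-descent σ b<a) (count-desE-insertions-after b σ b<a σ<a k) ⟩
  𝟙 (d ≡ᵇ k) + spread d (suc (length σ)) k
    ≡⟨ spread-suc k (insertion-bound a b σ) ⟩
  spread d (suc (suc (length σ))) k ∎
  where
  d = 𝟙 (isEven a) + desE (b ∷ σ)

insertions-length : ∀ a σ → All (λ τ → length τ ≡ suc (length σ)) (insertions a σ)
insertions-length a []      = refl ∷ []
insertions-length a (b ∷ σ) = refl ∷ map⁺ (All.map (cong suc) (insertions-length a σ))

insertions-All : ∀ {P : ℕ → Set} {a σ} → P a → All P σ → All (All P) (insertions a σ)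
insertions-All {σ = []}    pa []         = (pa ∷ []) ∷ []
insertions-All {σ = b ∷ σ} pa (pb ∷ pσ) = (pa ∷ pb ∷ pσ) ∷ map⁺ (All.map (pb ∷_) (insertions-All pa pσ))

𝒮-length : ∀ m → All (λ σ → length σ ≡ m) (𝒮 m)
𝒮-length zero    = refl ∷ []
𝒮-length (suc m) = concat⁺ (map⁺ (All.map grow (𝒮-length m)))
  where
  grow : ∀ {σ} → length σ ≡ m → All (λ τ → length τ ≡ suc m) (insertions (suc m) σ)
  grow {σ} len = All.map (λ len′ → trans len′ (cong suc len)) (insertions-length (suc m) σ)

𝒮-bounded : ∀ m → All (All (_< suc m)) (𝒮 m)
𝒮-bounded zero    = [] ∷ []
𝒮-bounded (suc m) = concat⁺ (map⁺ (All.map (insertions-All ≤-refl ∘ All.map m<n⇒m<1+n) (𝒮-bounded m)))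

count-desE-𝒮-vanishes : ∀ {m k} → m < k → count desE (𝒮 m) k ≡ 0
count-desE-𝒮-vanishes {m} {k} m<k = count-≡0 (All.map (λ {σ} → below σ) (𝒮-length m))
  where
  below : ∀ σ → length σ ≡ m → desE σ < k
  below σ refl = ≤-<-trans (desE-≤ σ) m<k

spread-count-∷ : ∀ (h : A → ℕ) x xs n k →
  spread (h x) n k + (suc k * count h xs (suc k) + (n ∸ k) * count h xs k)
    ≡ suc k * count h (x ∷ xs) (suc k) + (n ∸ k) * count h (x ∷ xs) k
spread-count-∷ h x xs n k = begin
  𝟙 (h x ≡ᵇ suc k) * suc k + 𝟙 (h x ≡ᵇ k) * (n ∸ k)
    + (suc k * count h xs (suc k) + (n ∸ k) * count h xs k)
    ≡⟨ regroup (suc k) (n ∸ k) (𝟙 (h x ≡ᵇ suc k)) (𝟙 (h x ≡ᵇ k)) (count h xs (suc k)) (count h xs k) ⟩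
  suc k * (𝟙 (h x ≡ᵇ suc k) + count h xs (suc k)) + (n ∸ k) * (𝟙 (h x ≡ᵇ k) + count h xs k)
    ≡⟨ sym (cong₂ (λ p q → suc k * p + (n ∸ k) * q) (count-∷ h x xs (suc k)) (count-∷ h x xs k)) ⟩
  suc k * count h (x ∷ xs) (suc k) + (n ∸ k) * count h (x ∷ xs) k ∎
  where
  regroup : ∀ a b x y p q → x * a + y * b + (a * p + b * q) ≡ a * (x + p) + b * (y + q)
  regroup = ℕ-Solver.solve-∀

count-desE-concatMap-insertions : ∀ {m β} → isEven (suc m) ≡ β → ∀ σs →
  All (λ σ → length σ ≡ m) σs → All (All (_< suc m)) σs → ∀ k →
  let h = λ σ → 𝟙 β + desE σ in
  count desE (concatMap (insertions (suc m)) σs) k ≡ suc k * count h σs (suc k) + (suc m ∸ k) * count h σs k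
count-desE-concatMap-insertions {m} refl [] [] [] k =
  sym (cong₂ _+_ (*-zeroʳ (suc k)) (*-zeroʳ (suc m ∸ k)))
count-desE-concatMap-insertions {m} refl (σ ∷ σs) (refl ∷ lens) (σ<a ∷ bnds) k = begin
  count desE (insertions (suc m) σ ++ concatMap (insertions (suc m)) σs) k
    ≡⟨ count-++ desE (insertions (suc m) σ) _ k ⟩
  count desE (insertions (suc m) σ) k + count desE (concatMap (insertions (suc m)) σs) k
    ≡⟨ cong₂ _+_ (count-desE-insertions σ σ<a k) (count-desE-concatMap-insertions refl σs lens bnds k) ⟩
  spread (h σ) (suc m) k + (suc k * count h σs (suc k) + (suc m ∸ k) * count h σs k)
    ≡⟨ spread-count-∷ h σ σs (suc m) k ⟩
  suc k * count h (σ ∷ σs) (suc k) + (suc m ∸ k) * count h (σ ∷ σs) k ∎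
  where
  h = λ σ → 𝟙 (isEven (suc m)) + desE σ

Σ≤-cong : ∀ k {f g : ℕ → ℤ} → (∀ i → f i ≡ g i) → Σ≤ k f ≡ Σ≤ k g
Σ≤-cong zero    f≗g = f≗g zero
Σ≤-cong (suc k) f≗g = cong₂ _+ᶻ_ (Σ≤-cong k f≗g) (f≗g (suc k))

Σ≤-zero : ∀ k {f : ℕ → ℤ} → (∀ i → f i ≡ + 0) → Σ≤ k f ≡ + 0
Σ≤-zero zero    f≗0 = f≗0 zero
Σ≤-zero (suc k) f≗0 = cong₂ _+ᶻ_ (Σ≤-zero k f≗0) (f≗0 (suc k))

Σ≤-suc : ∀ k (f : ℕ → ℤ) → Σ≤ (suc k) f ≡ f 0 +ᶻ Σ≤ k (f ∘ suc)
Σ≤-suc zero    f = refl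
Σ≤-suc (suc k) f = trans (cong (_+ᶻ f (suc (suc k))) (Σ≤-suc k f)) (ℤ.+-assoc (f 0) _ _)

Σ≤-+ : ∀ k (f g : ℕ → ℤ) → Σ≤ k (λ i → f i +ᶻ g i) ≡ Σ≤ k f +ᶻ Σ≤ k g
Σ≤-+ zero    f g = refl
Σ≤-+ (suc k) f g = trans (cong (_+ᶻ (f (suc k) +ᶻ g (suc k))) (Σ≤-+ k f g))
  (interchange (Σ≤ k f) (Σ≤ k g) (f (suc k)) (g (suc k)))
  where
  interchange : ∀ a b c d → (a +ᶻ b) +ᶻ (c +ᶻ d) ≡ (a +ᶻ c) +ᶻ (b +ᶻ d)
  interchange = solve-∀

Σ≤-- : ∀ k (f g : ℕ → ℤ) → Σ≤ k (λ i → f i -ᶻ g i) ≡ Σ≤ k f -ᶻ Σ≤ k g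
Σ≤-- zero    f g = refl
Σ≤-- (suc k) f g = trans (cong (_+ᶻ (f (suc k) -ᶻ g (suc k))) (Σ≤-- k f g))
  (interchange (Σ≤ k f) (Σ≤ k g) (f (suc k)) (g (suc k)))
  where
  interchange : ∀ a b c d → (a -ᶻ b) +ᶻ (c -ᶻ d) ≡ (a +ᶻ c) -ᶻ (b +ᶻ d)
  interchange = solve-∀

⊗-congˡ : ∀ {P P′} S k → (∀ i → P i ≡ P′ i) → (P ⊗ S) k ≡ (P′ ⊗ S) k
⊗-congˡ S k P≗P′ = Σ≤-cong k (λ i → cong (_*ᶻ S (k ∸ i)) (P≗P′ i))

⊗-distribʳ-⊕ : ∀ P Q S k → ((P ⊕ Q) ⊗ S) k ≡ (P ⊗ S) k +ᶻ (Q ⊗ S) k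
⊗-distribʳ-⊕ P Q S k = trans (Σ≤-cong k (λ i → ℤ.*-distribʳ-+ (S (k ∸ i)) (P i) (Q i))) (Σ≤-+ k _ _)

⊗-distribʳ-⊖ : ∀ P Q S k → ((P ⊖ Q) ⊗ S) k ≡ (P ⊗ S) k -ᶻ (Q ⊗ S) k
⊗-distribʳ-⊖ P Q S k = trans (Σ≤-cong k (λ i → distrib (P i) (Q i) (S (k ∸ i)))) (Σ≤-- k _ _)
  where
  distrib : ∀ a b c → (a -ᶻ b) *ᶻ c ≡ a *ᶻ c -ᶻ b *ᶻ c
  distrib = solve-∀

const-⊗ : ∀ c Q k → (const c ⊗ Q) k ≡ c *ᶻ Q k
const-⊗ c Q zero    = refl
const-⊗ c Q (suc k) = begin
  (const c ⊗ Q) (suc k)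
    ≡⟨ Σ≤-suc k _ ⟩
  c *ᶻ Q (suc k) +ᶻ Σ≤ k (λ i → + 0 *ᶻ Q (k ∸ i))
    ≡⟨ cong (c *ᶻ Q (suc k) +ᶻ_) (Σ≤-zero k (λ i → ℤ.*-zeroˡ (Q (k ∸ i)))) ⟩
  c *ᶻ Q (suc k) +ᶻ + 0
    ≡⟨ ℤ.+-identityʳ _ ⟩
  c *ᶻ Q (suc k) ∎

X·-cong : ∀ {P P′} k → (∀ i → P i ≡ P′ i) → X· P k ≡ X· P′ k
X·-cong zero    P≗P′ = refl
X·-cong (suc k) P≗P′ = P≗P′ k

X·-⊕ : ∀ P Q k → X· (P ⊕ Q) k ≡ X· P k +ᶻ X· Q k
X·-⊕ P Q zero    = refl
X·-⊕ P Q (suc k) = refl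

X·-⊗ : ∀ P Q k → (X· P ⊗ Q) k ≡ X· (P ⊗ Q) k
X·-⊗ P Q zero    = refl
X·-⊗ P Q (suc k) = trans (Σ≤-suc k _) (ℤ.+-identityˡ _)

𝕏-⊗ : ∀ Q k → (𝕏 ⊗ Q) k ≡ X· Q k
𝕏-⊗ Q k = trans (X·-⊗ (const (+ 1)) Q k) (X·-cong k (λ i → trans (const-⊗ (+ 1) Q i) (ℤ.*-identityˡ (Q i))))

X·-D : ∀ P k → X· (D P) k ≡ + k *ᶻ P k
X·-D P zero    = sym (ℤ.*-zeroˡ (P 0))
X·-D P (suc k) = refl

oddStep : Poly → ℤ → Poly
oddStep P c = (const (+ 1) ⊖ 𝕏) ⊗ D P ⊕ const c ⊗ P

evenStep : Poly → ℤ → Poly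
evenStep P c = 𝕏 ⊗ (const (+ 1) ⊖ 𝕏) ⊗ D P ⊕ (const (+ 1) ⊕ 𝕏 ⊗ const c) ⊗ P

oddStep-coeff : ∀ P c k → oddStep P c k ≡ + suc k *ᶻ P (suc k) -ᶻ + k *ᶻ P k +ᶻ c *ᶻ P k
oddStep-coeff P c k = begin
  ((const (+ 1) ⊖ 𝕏) ⊗ D P) k +ᶻ (const c ⊗ P) k
    ≡⟨ cong₂ _+ᶻ_ (⊗-distribʳ-⊖ (const (+ 1)) 𝕏 (D P) k) (const-⊗ c P k) ⟩
  (const (+ 1) ⊗ D P) k -ᶻ (𝕏 ⊗ D P) k +ᶻ c *ᶻ P k
    ≡⟨ cong (λ z → z +ᶻ c *ᶻ P k)
            (cong₂ _-ᶻ_ (const-⊗ (+ 1) (D P) k) (trans (𝕏-⊗ (D P) k) (X·-D P k))) ⟩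
  + 1 *ᶻ D P k -ᶻ + k *ᶻ P k +ᶻ c *ᶻ P k
    ≡⟨ cong (λ z → z -ᶻ + k *ᶻ P k +ᶻ c *ᶻ P k) (ℤ.*-identityˡ (D P k)) ⟩
  + suc k *ᶻ P (suc k) -ᶻ + k *ᶻ P k +ᶻ c *ᶻ P k ∎

evenStep-X·-oddStep : ∀ P c k → evenStep P c k ≡ X· (oddStep P c) k +ᶻ P k
evenStep-X·-oddStep P c k = begin
  ((𝕏 ⊗ (const (+ 1) ⊖ 𝕏)) ⊗ D P) k +ᶻ ((const (+ 1) ⊕ 𝕏 ⊗ const c) ⊗ P) k
    ≡⟨ cong₂ _+ᶻ_ (trans (⊗-congˡ (D P) k (𝕏-⊗ (const (+ 1) ⊖ 𝕏)))
                         (X·-⊗ (const (+ 1) ⊖ 𝕏) (D P) k))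
                  (⊗-distribʳ-⊕ (const (+ 1)) (𝕏 ⊗ const c) P k) ⟩
  X· ((const (+ 1) ⊖ 𝕏) ⊗ D P) k +ᶻ ((const (+ 1) ⊗ P) k +ᶻ ((𝕏 ⊗ const c) ⊗ P) k)
    ≡⟨ cong (X· ((const (+ 1) ⊖ 𝕏) ⊗ D P) k +ᶻ_)
         (cong₂ _+ᶻ_ (trans (const-⊗ (+ 1) P k) (ℤ.*-identityˡ (P k)))
                     (trans (⊗-congˡ P k (𝕏-⊗ (const c))) (X·-⊗ (const c) P k))) ⟩
  X· ((const (+ 1) ⊖ 𝕏) ⊗ D P) k +ᶻ (P k +ᶻ X· (const c ⊗ P) k)
    ≡⟨ rearrange (X· ((const (+ 1) ⊖ 𝕏) ⊗ D P) k) (P k) (X· (const c ⊗ P) k) ⟩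
  (X· ((const (+ 1) ⊖ 𝕏) ⊗ D P) k +ᶻ X· (const c ⊗ P) k) +ᶻ P k
    ≡⟨ cong (_+ᶻ P k) (sym (X·-⊕ ((const (+ 1) ⊖ 𝕏) ⊗ D P) (const c ⊗ P) k)) ⟩
  X· (oddStep P c) k +ᶻ P k ∎
  where
  rearrange : ∀ a p b → a +ᶻ (p +ᶻ b) ≡ (a +ᶻ b) +ᶻ p
  rearrange = solve-∀

evenStep-coeff : ∀ P c k →
  evenStep P c k ≡ + suc k *ᶻ P k -ᶻ (+ k -ᶻ + 1) *ᶻ X· P k +ᶻ c *ᶻ X· P k
evenStep-coeff P c zero = trans (evenStep-X·-oddStep P c zero) (at-zero (P 0) c)
  where
  at-zero : ∀ p c → + 0 +ᶻ p ≡ + 1 *ᶻ p -ᶻ (+ 0 -ᶻ + 1) *ᶻ + 0 +ᶻ c *ᶻ + 0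
  at-zero = solve-∀
evenStep-coeff P c (suc k) = begin
  evenStep P c (suc k)
    ≡⟨ evenStep-X·-oddStep P c (suc k) ⟩
  oddStep P c k +ᶻ P (suc k)
    ≡⟨ cong (_+ᶻ P (suc k)) (oddStep-coeff P c k) ⟩
  + suc k *ᶻ P (suc k) -ᶻ + k *ᶻ P k +ᶻ c *ᶻ P k +ᶻ P (suc k)
    ≡⟨ at-suc (+ k) (P (suc k)) (P k) c ⟩
  + suc (suc k) *ᶻ P (suc k) -ᶻ (+ suc k -ᶻ + 1) *ᶻ P k +ᶻ c *ᶻ P k ∎
  where
  at-suc : ∀ K p q c →
    (+ 1 +ᶻ K) *ᶻ p -ᶻ K *ᶻ q +ᶻ c *ᶻ q +ᶻ p
      ≡ (+ 1 +ᶻ (+ 1 +ᶻ K)) *ᶻ p -ᶻ ((+ 1 +ᶻ K) -ᶻ + 1) *ᶻ q +ᶻ c *ᶻ q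
  at-suc = solve-∀

pos-∸-* : ∀ n k y → (n < k → y ≡ 0) → + ((n ∸ k) * y) ≡ (+ n -ᶻ + k) *ᶻ + y
pos-∸-* n k y vanish with k ≤? n
... | yes k≤n = trans (ℤ.pos-* (n ∸ k) y) (cong (_*ᶻ + y) (sym (trans (ℤ.m-n≡m⊖n n k) (ℤ.⊖-≥ k≤n))))
... | no  k≰n rewrite vanish (≰⇒> k≰n) = trans (cong +_ (*-zeroʳ (n ∸ k))) (sym (ℤ.*-zeroʳ (+ n -ᶻ + k)))

pos-recurrence : ∀ n k x y → (n < k → y ≡ 0) →
  + (suc k * x + (n ∸ k) * y) ≡ + suc k *ᶻ + x +ᶻ (+ n -ᶻ + k) *ᶻ + y
pos-recurrence n k x y vanish =
  trans (ℤ.pos-+ (suc k * x) _) (cong₂ _+ᶻ_ (ℤ.pos-* (suc k) x) (pos-∸-* n k y vanish))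

R-suc-odd : ∀ m → isEven (suc m) ≡ false → ∀ k → R (suc m) k ≡ oddStep (R m) (+ suc m) k
R-suc-odd m odd k = begin
  R (suc m) k
    ≡⟨ cong +_ (count-desE-concatMap-insertions odd (𝒮 m) (𝒮-length m) (𝒮-bounded m) k) ⟩
  + (suc k * N (suc k) + (suc m ∸ k) * N k)
    ≡⟨ pos-recurrence (suc m) k _ _ vanish ⟩
  + suc k *ᶻ R m (suc k) +ᶻ (+ suc m -ᶻ + k) *ᶻ R m k
    ≡⟨ regroup (+ k) (+ m) (R m (suc k)) (R m k) ⟩
  + suc k *ᶻ R m (suc k) -ᶻ + k *ᶻ R m k +ᶻ + suc m *ᶻ R m k
    ≡⟨ sym (oddStep-coeff (R m) (+ suc m) k) ⟩
  oddStep (R m) (+ suc m) k ∎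
  where
  N = count desE (𝒮 m)
  vanish : suc m < k → N k ≡ 0
  vanish m+1<k = count-desE-𝒮-vanishes (≤-trans (n≤1+n (suc m)) m+1<k)
  regroup : ∀ K M y z →
    (+ 1 +ᶻ K) *ᶻ y +ᶻ ((+ 1 +ᶻ M) -ᶻ K) *ᶻ z ≡ (+ 1 +ᶻ K) *ᶻ y -ᶻ K *ᶻ z +ᶻ (+ 1 +ᶻ M) *ᶻ z
  regroup = solve-∀

R-suc-even : ∀ m → isEven (suc m) ≡ true → ∀ k → R (suc m) k ≡ evenStep (R m) (+ m) k
R-suc-even m even k = begin
  R (suc m) k
    ≡⟨ cong +_ (count-desE-concatMap-insertions even (𝒮 m) (𝒮-length m) (𝒮-bounded m) k) ⟩
  + (suc k * N′ (suc k) + (suc m ∸ k) * N′ k)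
    ≡⟨ pos-recurrence (suc m) k _ _ vanish ⟩
  + suc k *ᶻ R m k +ᶻ (+ suc m -ᶻ + k) *ᶻ + N′ k
    ≡⟨ cong (λ z → + suc k *ᶻ R m k +ᶻ (+ suc m -ᶻ + k) *ᶻ z) (pos-N′ k) ⟩
  + suc k *ᶻ R m k +ᶻ (+ suc m -ᶻ + k) *ᶻ X· (R m) k
    ≡⟨ regroup (+ k) (+ m) (R m k) (X· (R m) k) ⟩
  + suc k *ᶻ R m k -ᶻ (+ k -ᶻ + 1) *ᶻ X· (R m) k +ᶻ + m *ᶻ X· (R m) k
    ≡⟨ sym (evenStep-coeff (R m) (+ m) k) ⟩
  evenStep (R m) (+ m) k ∎
  where
  N′ = count (suc ∘ desE) (𝒮 m)
  vanish : ∀ {j} → suc m < j → N′ j ≡ 0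
  vanish {suc j} m+1<j+1 = count-desE-𝒮-vanishes (s≤s⁻¹ m+1<j+1)
  pos-N′ : ∀ k → + N′ k ≡ X· (R m) k
  pos-N′ zero    = cong +_ (count-suc desE (𝒮 m) zero)
  pos-N′ (suc k) = refl
  regroup : ∀ K M y z →
    (+ 1 +ᶻ K) *ᶻ y +ᶻ ((+ 1 +ᶻ M) -ᶻ K) *ᶻ z ≡ (+ 1 +ᶻ K) *ᶻ y -ᶻ (K -ᶻ + 1) *ᶻ z +ᶻ M *ᶻ z
  regroup = solve-∀

isEven-1+2n : ∀ n → isEven (suc (2 * n)) ≡ false
isEven-1+2n n = cong (_≡ᵇ 0) (trans (cong (λ m → suc m % 2) (*-comm 2 n)) ([m+kn]%n≡m%n 1 n 2))

isEven-2n+2 : ∀ n → isEven (suc (2 * n + 1)) ≡ true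
isEven-2n+2 n = cong (_≡ᵇ 0) (trans (cong (_% 2) (as-multiple n)) (m*n%n≡0 (suc n) 2))
  where
  as-multiple : ∀ n → suc (2 * n + 1) ≡ suc n * 2
  as-multiple = ℕ-Solver.solve-∀

corollary3p2 : (∀ k → R 1 k ≡ const (+ 1) k)
    × (∀ k → R 2 k ≡ (const (+ 1) ⊕ 𝕏) k)
    × (∀ (n : ℕ) → 1 Data.Nat.≤ n → ∀ k →
        R (2 * n + 1) k
          ≡ ((const (+ 1) ⊖ 𝕏) ⊗ D (R (2 * n)) ⊕ const (+ (1 + 2 * n)) ⊗ R (2 * n)) k)
    × (∀ (n : ℕ) → 1 Data.Nat.≤ n → ∀ k →
        R (2 * n + 2) k
          ≡ (𝕏 ⊗ (const (+ 1) ⊖ 𝕏) ⊗ D (R (2 * n + 1))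
              ⊕ (const (+ 1) ⊕ 𝕏 ⊗ const (+ (1 + 2 * n))) ⊗ R (2 * n + 1)) k)
corollary3p2 = R₁ , R₂ , R-odd , R-even
  where
  R₁ : ∀ k → R 1 k ≡ const (+ 1) k
  R₁ zero    = refl
  R₁ (suc k) = refl

  R₂ : ∀ k → R 2 k ≡ (const (+ 1) ⊕ 𝕏) k
  R₂ zero          = refl
  R₂ (suc zero)    = refl
  R₂ (suc (suc k)) = refl

  -- Both recurrences hold for n = 0 as well.
  R-odd : ∀ n → 1 ≤ n → ∀ k → R (2 * n + 1) k ≡ oddStep (R (2 * n)) (+ (1 + 2 * n)) k
  R-odd n _ k = begin
    R (2 * n + 1) k                  ≡⟨ cong (λ m → R m k) (+-comm (2 * n) 1) ⟩
    R (suc (2 * n)) k                ≡⟨ R-suc-odd (2 * n) (isEven-1+2n n) k ⟩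
    oddStep (R (2 * n)) (+ (1 + 2 * n)) k ∎

  R-even : ∀ n → 1 ≤ n → ∀ k → R (2 * n + 2) k ≡ evenStep (R (2 * n + 1)) (+ (1 + 2 * n)) k
  R-even n _ k = begin
    R (2 * n + 2) k
      ≡⟨ cong (λ m → R m k) (+-suc (2 * n) 1) ⟩
    R (suc (2 * n + 1)) k
      ≡⟨ R-suc-even (2 * n + 1) (isEven-2n+2 n) k ⟩
    evenStep (R (2 * n + 1)) (+ (2 * n + 1)) k
      ≡⟨ cong (λ c → evenStep (R (2 * n + 1)) (+ c) k) (+-comm (2 * n) 1) ⟩
    evenStep (R (2 * n + 1)) (+ (1 + 2 * n)) k ∎
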